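{- For each integer $k\ge3$ there exists $c\ge k$ such that there is no minion homomorphism from $\mathrm{Pol}(\mathbf K_k,\mathbf K_c)$ to $\mathrm{Pol}(\mathbf K_{k'},\mathbf K_{c'})$ for any integers $k<k'\le c'$.
   Context: $\mathbf K_n$ has domain $\{0,\dots,n-1\}$ and the binary relation $\ne$; $\mathrm{Pol}(\mathbf K_k,\mathbf K_c)$ is the set of maps $f\colon\{0,\dots,k-1\}^n\to\{0,\dots,c-1\}$ ($n\ge1$) with $f(\mathbf a)\ne f(\mathbf b)$ whenever $a_i\ne b_i$ for all $i$. A minion homomorphism between sets of functions closed under minors $g\mapsto g(x_{\pi(1)},\dots,x_{\pi(m)})$ is a map preserving arities and minors. -}

module Defs where

open import Data.Nat using (ℕ; suc)
open import Data.Fin using (Fin)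
open import Data.Product using (Σ; _,_; proj₁)
open import Function using (_∘_)
open import Relation.Binary.PropositionalEquality using (_≡_; _≢_)

-- Pol(K_k, K_c) restricted to arity n:
-- maps f : Fin k ^ n → Fin c with f a ≢ f b whenever a i ≢ b i for all i.
Pol : ℕ → ℕ → ℕ → Set
Pol k c n =
  Σ ((Fin n → Fin k) → Fin c) λ f →
    ∀ (a b : Fin n → Fin k) → (∀ i → a i ≢ b i) → f a ≢ f b

fun : ∀ {k c n} → Pol k c n → (Fin n → Fin k) → Fin c
fun = proj₁

minor : ∀ {k c n m} → (Fin n → Fin m) → Pol k c n → Pol k c m
minor π (f , p) = (λ y → f (y ∘ π)) , λ a b a≢b → p (a ∘ π) (b ∘ π) (λ i → a≢b (π i))

_≈_ : ∀ {k c n} → Pol k c n → Pol k c n → Set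
f ≈ g = ∀ x → fun f x ≡ fun g x

-- minion homomorphism Pol(K_k,K_c) → Pol(K_k',K_c') (arities n ≥ 1, written suc n)
record MinionHom (k c k' c' : ℕ) : Set where
  field
    ξ : ∀ {n} → Pol k c (suc n) → Pol k' c' (suc n)
    ξ-cong : ∀ {n} (f g : Pol k c (suc n)) → f ≈ g → ξ f ≈ ξ g
    ξ-minor : ∀ {n m} (π : Fin (suc n) → Fin (suc m)) (f : Pol k c (suc n)) →
              ξ (minor π f) ≈ minor π (ξ f)

module Submission where

-- A minion homomorphism preserves every identity between two minors
-- of one function, f^π ≈ f^σ.  We exhibit, for every k ≥ 1, a polymorphism
-- h ∈ Pol(K_k, K_c) of arity N = (k+1)k satisfying such a "loop identity":
-- the N coordinates are the directed edges e of the complete digraph on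
-- k+1 vertices, and h^tail ≈ h^head.  No polymorphism of (K_k', K_c') with
-- k' > k satisfies it: colouring the k+1 vertices injectively by k' colours
-- gives tuples z ∘ tail and z ∘ head that differ in every coordinate, so
-- they must get different values.
--
-- The function h is a symmetrisation.  For an arbitrary map s on the
-- coordinates, a tuple x that repeats along s (x e ≡ x (s e) for some e)
-- is sent to min(code x, code (x ∘ s)); any other tuple to code x (with a
-- separate tag), where code is an injective coding of tuples.  This is a
-- polymorphism for every s.  With s the edge reversal, the tuples y ∘ tail
-- and y ∘ head are each other's reversals and, by pigeonhole on the k+1
-- vertices coloured by k colours, repeat along s; so they get the same value.

open import Defs
open import Data.Nat using (ℕ; _≤_; _<_; zero; suc; _+_; _*_; _^_; s≤s; z≤n)
import Data.Nat.Properties as ℕP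
open import Data.Fin as Fin
  using (Fin; funToFin; finToFun; join; splitAt; remQuot; combine; punchIn; punchOut; inject≤)
import Data.Fin.Properties as FinP
open import Data.Product using (Σ; _×_; _,_; proj₁; proj₂; ∃)
open import Data.Sum using (_⊎_; inj₁; inj₂)
open import Data.Sum.Properties using (inj₁-injective; inj₂-injective)
open import Data.Empty using (⊥-elim)
open import Relation.Nullary using (¬_; Dec; yes; no)
open import Relation.Binary.PropositionalEquality
  using (_≡_; _≢_; _≗_; refl; sym; trans; cong; cong₂; subst; module ≡-Reasoning)
open import Function using (_∘_)

open ≡-Reasoning

hom-preserves-identity :
  ∀ {k c k' c' n m} (M : MinionHom k c k' c') (π σ : Fin (suc n) → Fin (suc m))
  (f : Pol k c (suc n)) →
  minor π f ≈ minor σ f → minor π (MinionHom.ξ M f) ≈ minor σ (MinionHom.ξ M f)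
hom-preserves-identity M π σ f f^π≈f^σ y = begin
  fun (minor π (ξ f)) y  ≡⟨ ξ-minor π f y ⟨
  fun (ξ (minor π f)) y  ≡⟨ ξ-cong (minor π f) (minor σ f) f^π≈f^σ y ⟩
  fun (ξ (minor σ f)) y  ≡⟨ ξ-minor σ f y ⟩
  fun (minor σ (ξ f)) y  ∎
  where open MinionHom M

separated-identity-fails :
  ∀ {k c n m} (f : Pol k c n) (π σ : Fin n → Fin m) (z : Fin m → Fin k) →
  (∀ e → z (π e) ≢ z (σ e)) → ¬ (minor π f ≈ minor σ f)
separated-identity-fails (f , preserves-≢) π σ z separates f^π≈f^σ =
  preserves-≢ (z ∘ π) (z ∘ σ) separates (f^π≈f^σ z)

funToFin-cong : ∀ {m n} {f g : Fin m → Fin n} → f ≗ g → funToFin f ≡ funToFin g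
funToFin-cong {zero}  f≗g = refl
funToFin-cong {suc m} f≗g = cong₂ combine (f≗g Fin.zero) (funToFin-cong (f≗g ∘ Fin.suc))

funToFin-injective : ∀ {m n} {f g : Fin m → Fin n} → funToFin f ≡ funToFin g → f ≗ g
funToFin-injective {f = f} {g} eq i = begin
  f i                         ≡⟨ FinP.finToFun-funToFin f i ⟨
  finToFun (funToFin f) i     ≡⟨ cong (λ t → finToFun t i) eq ⟩
  finToFun (funToFin g) i     ≡⟨ FinP.finToFun-funToFin g i ⟩
  g i                         ∎

join-injective : ∀ {m n} {u v : Fin m ⊎ Fin n} → join m n u ≡ join m n v → u ≡ v
join-injective {m} {n} {u} {v} eq = begin
  u                       ≡⟨ FinP.splitAt-join m n u ⟨
  splitAt m (join m n u)  ≡⟨ cong (splitAt m) eq ⟩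
  splitAt m (join m n v)  ≡⟨ FinP.splitAt-join m n v ⟩
  v                       ∎

Disjoint : ∀ {n k} → (Fin n → Fin k) → (Fin n → Fin k) → Set
Disjoint a b = ∀ i → a i ≢ b i

Repeats : ∀ {n k} → (Fin n → Fin n) → (Fin n → Fin k) → Set
Repeats s x = ∃ λ e → x e ≡ x (s e)

repeat-blocks-shift : ∀ {n k} {s : Fin n → Fin n} {a b : Fin n → Fin k} →
  Repeats s a → Disjoint a b → ¬ (a ≗ b ∘ s)
repeat-blocks-shift (e , ae≡ase) disjoint a≗bs = disjoint _ (trans (sym ae≡ase) (a≗bs e))

module Symmetrised {k n : ℕ} (s : Fin (suc n) → Fin (suc n)) where

  Tuple : Set
  Tuple = Fin (suc n) → Fin k

  K : ℕ
  K = k ^ suc n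

  open import Algebra.Construct.NaturalChoice.Min (FinP.≤-totalOrder K)
    using (_⊓_; ⊓-comm; ⊓-sel)

  code : Tuple → Fin K
  code = funToFin

  symCode : Tuple → Fin K
  symCode x = code x ⊓ code (x ∘ s)

  repeats? : (x : Tuple) → Dec (Repeats s x)
  repeats? x = FinP.any? (λ e → x e FinP.≟ x (s e))

  tag : (x : Tuple) → Dec (Repeats s x) → Fin K ⊎ Fin K
  tag x (yes _) = inj₁ (symCode x)
  tag x (no _)  = inj₂ (code x)

  selected-equal : ∀ {a b : Tuple} (a' b' : Tuple) → symCode a ≡ symCode b →
                   symCode a ≡ code a' → symCode b ≡ code b' → a' ≗ b'
  selected-equal a' b' eq p q =
    funToFin-injective {f = a'} {g = b'} (trans (sym p) (trans eq q))

  symCode-disjoint : ∀ {a b : Tuple} → Repeats s a → Repeats s b → Disjoint a b →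
                     symCode a ≢ symCode b
  symCode-disjoint {a} {b} ra@(e , _) rb disjoint eq
    with ⊓-sel (code a) (code (a ∘ s)) | ⊓-sel (code b) (code (b ∘ s))
  ... | inj₁ p | inj₁ q = disjoint e (selected-equal {a} {b} a b eq p q e)
  ... | inj₁ p | inj₂ q =
    repeat-blocks-shift ra disjoint (selected-equal {a} {b} a (b ∘ s) eq p q)
  ... | inj₂ p | inj₁ q =
    repeat-blocks-shift rb (λ i → disjoint i ∘ sym) (sym ∘ selected-equal {a} {b} (a ∘ s) b eq p q)
  ... | inj₂ p | inj₂ q = disjoint (s e) (selected-equal {a} {b} (a ∘ s) (b ∘ s) eq p q e)

  tag-disjoint : ∀ (a b : Tuple) → Disjoint a b → ∀ da db → tag a da ≢ tag b db
  tag-disjoint a b disjoint (yes ra) (yes rb) eq =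
    symCode-disjoint ra rb disjoint (inj₁-injective eq)
  tag-disjoint a b disjoint (no _) (no _) eq =
    disjoint Fin.zero (funToFin-injective {f = a} {g = b} (inj₂-injective eq) Fin.zero)
  tag-disjoint a b disjoint (yes _) (no _) ()
  tag-disjoint a b disjoint (no _) (yes _) ()

  symPol : Pol k (K + K) (suc n)
  symPol = (λ x → join K K (tag x (repeats? x)))
         , λ a b disjoint eq → tag-disjoint a b disjoint (repeats? a) (repeats? b) (join-injective eq)

  tag-swap : ∀ (x x' : Tuple) → x ∘ s ≗ x' → x' ∘ s ≗ x → Repeats s x → Repeats s x' →
             ∀ dx dx' → tag x dx ≡ tag x' dx'
  tag-swap x x' xs≗x' x's≗x rx rx' (no ¬rx) _ = ⊥-elim (¬rx rx)
  tag-swap x x' xs≗x' x's≗x rx rx' (yes _) (no ¬rx') = ⊥-elim (¬rx' rx')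
  tag-swap x x' xs≗x' x's≗x rx rx' (yes _) (yes _) = cong inj₁ (begin
    code x ⊓ code (x ∘ s)    ≡⟨ cong (code x ⊓_) (funToFin-cong xs≗x') ⟩
    code x ⊓ code x'         ≡⟨ ⊓-comm (code x) (code x') ⟩
    code x' ⊓ code x         ≡⟨ cong (code x' ⊓_) (funToFin-cong x's≗x) ⟨
    code x' ⊓ code (x' ∘ s)  ∎)

  symPol-swap : ∀ (x x' : Tuple) → x ∘ s ≗ x' → x' ∘ s ≗ x → Repeats s x → Repeats s x' →
                fun symPol x ≡ fun symPol x'
  symPol-swap x x' xs≗x' x's≗x rx rx' =
    cong (join K K) (tag-swap x x' xs≗x' x's≗x rx rx' (repeats? x) (repeats? x'))

-- The complete digraph on the vertices Fin (suc v): an edge e ∈ Fin (suc v * v)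
-- is the pair of its tail and a vertex different from the tail, its head.

module CompleteDigraph (v : ℕ) where

  Edge : Set
  Edge = Fin (suc v * v)

  tail : Edge → Fin (suc v)
  tail e = proj₁ (remQuot {suc v} v e)

  head : Edge → Fin (suc v)
  head e = punchIn (tail e) (proj₂ (remQuot {suc v} v e))

  head≢tail : ∀ e → head e ≢ tail e
  head≢tail e = FinP.punchInᵢ≢i (tail e) _

  edge : ∀ {i j : Fin (suc v)} → i ≢ j → Edge
  edge {i} i≢j = combine i (punchOut i≢j)

  tail-edge : ∀ {i j : Fin (suc v)} (i≢j : i ≢ j) → tail (edge i≢j) ≡ i
  tail-edge {i} i≢j = cong proj₁ (FinP.remQuot-combine {suc v} {v} i (punchOut i≢j))

  head-edge : ∀ {i j : Fin (suc v)} (i≢j : i ≢ j) → head (edge i≢j) ≡ j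
  head-edge {i} {j} i≢j = begin
    head (edge i≢j)             ≡⟨ cong (λ r → punchIn (proj₁ r) (proj₂ r))
                                        (FinP.remQuot-combine {suc v} {v} i (punchOut i≢j)) ⟩
    punchIn i (punchOut i≢j)    ≡⟨ FinP.punchIn-punchOut i≢j ⟩
    j                           ∎

  reverse : Edge → Edge
  reverse e = edge (head≢tail e)

  tail-reverse : ∀ e → tail (reverse e) ≡ head e
  tail-reverse e = tail-edge (head≢tail e)

  head-reverse : ∀ e → head (reverse e) ≡ tail e
  head-reverse e = head-edge (head≢tail e)

  monochromatic-edge : ∀ {j} → j < suc v → (y : Fin (suc v) → Fin j) →
                       ∃ λ e → y (tail e) ≡ y (head e)
  monochromatic-edge j<v y with FinP.pigeonhole j<v y
  ... | i , i' , i<i' , yi≡yi' =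
    let i≢i' = FinP.<⇒≢ i<i' in
    edge i≢i' , trans (cong y (tail-edge i≢i')) (trans yi≡yi' (cong y (sym (head-edge i≢i'))))

module Loop (k₀ : ℕ) where

  k : ℕ
  k = suc k₀

  open CompleteDigraph k
  open Symmetrised {k} {k₀ + k * k} reverse using (symPol; symPol-swap)

  colours : ℕ
  colours = k ^ (suc k * k) + k ^ (suc k * k)

  loopPol : Pol k colours (suc k * k)
  loopPol = symPol

  k≤colours : k ≤ colours
  k≤colours = ℕP.≤-trans k≤k^N (ℕP.m≤m+n _ _)
    where
    k≤k^N : k ≤ k ^ (suc k * k)
    k≤k^N = subst (_≤ k ^ (suc k * k)) (ℕP.^-identityʳ k) (ℕP.^-monoʳ-≤ k {1} {suc k * k} (s≤s z≤n))

  -- y ∘ tail and y ∘ head are each other's reversals, and both repeat along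
  -- reversal at an edge that y (with only k colours) makes monochromatic.
  loop-identity : minor tail loopPol ≈ minor head loopPol
  loop-identity y with monochromatic-edge ℕP.≤-refl y
  ... | e , mono =
    symPol-swap (y ∘ tail) (y ∘ head)
      (cong y ∘ tail-reverse) (cong y ∘ head-reverse)
      (e , trans mono (cong y (sym (tail-reverse e))))
      (e , trans (sym mono) (cong y (sym (head-reverse e))))

  -- An injective colouring of the suc k vertices by k' > k colours separates
  -- every edge, so no minion homomorphism into Pol(K_k', K_c') exists.
  no-minion-hom : ∀ k' c' → k < k' → ¬ MinionHom k colours k' c'
  no-minion-hom k' c' k<k' M =
    separated-identity-fails (MinionHom.ξ M loopPol) tail head z separates
      (hom-preserves-identity M tail head loopPol loop-identity)
    where
    z : Fin (suc k) → Fin k'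
    z i = inject≤ i k<k'
    separates : ∀ e → z (tail e) ≢ z (head e)
    separates e eq = head≢tail e (sym (FinP.inject≤-injective k<k' k<k' _ _ eq))

-- The construction works for every k ≥ 1; the hypothesis 3 ≤ k only excludes k = 0.
proposition10p3 : ∀ (k : ℕ) → 3 ≤ k →
    Σ ℕ λ c → k ≤ c × (∀ (k' c' : ℕ) → k < k' → k' ≤ c' → ¬ MinionHom k c k' c')
proposition10p3 (suc k₀) _ =
  colours , k≤colours , λ k' c' k<k' _ → no-minion-hom k' c' k<k'
  where open Loop k₀
proposition10p3 zero ()
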